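{- For every integer $x\ge1$ there is a prime $p(x)$ that divides no member of the set $\{\star^kx+1: k\ge0\}$.
   Context: Define $\star:\mathbf{N}\to\mathbf{N}$ (where $\mathbf{N}=\{1,2,3,\ldots\}$) by $\star x=x(x+1)$; $\star^0$ is the identity and $\star^{k+1}=\star^k\circ\star$. -}

module Defs where

open import Data.Nat using (ℕ; zero; suc; _*_; _+_)

⋆ : ℕ → ℕ
⋆ x = x * (x + 1)

⋆^ : ℕ → ℕ → ℕ
⋆^ zero    x = x
⋆^ (suc k) x = ⋆^ k (⋆ x)

-- If x ≥ 2, any prime factor of x divides x (x + 1) and hence every ⋆ᵏ x, so it cannot
-- divide ⋆ᵏ x + 1. For x = 1 take p = 5: modulo 5 the orbit of 1 under ⋆ is 1, 2, 1, 2, …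
-- (since ⋆ 2 = 6), so ⋆ᵏ 1 + 1 is always 2 or 3 modulo 5.
{-# OPTIONS --safe #-}
module Submission where

open import Defs
open import Data.Nat using (ℕ; zero; suc; _+_; _*_; _%_; _≤_; NonZero; NonTrivial; nonTrivial⇒nonZero; nonTrivial⇒≢1)
open import Data.Nat.DivMod using (%-distribˡ-+; %-distribˡ-*; m%n%n≡m%n)
open import Data.Nat.Divisibility using (_∣_; ∣m⇒∣m*n; ∣m+n∣m⇒∣n; ∣1⇒≡1; m∣m*n; n∣m⇒m%n≡0)
open import Data.Nat.Primality using (Prime; prime?; prime⇒nonTrivial)
open import Data.Nat.Primality.Factorisation using (factorise)
open import Data.List using ([]; _∷_)
open import Data.List.Relation.Unary.All using (_∷_)
open import Data.Product using (Σ; ∃-syntax; _×_; _,_)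
open import Data.Sum using (_⊎_; inj₁; inj₂)
open import Relation.Nullary using (¬_; contradiction)
open import Relation.Nullary.Decidable using (from-yes)
open import Relation.Binary.PropositionalEquality using (_≡_; refl; sym; trans; cong; module ≡-Reasoning)

⋆^-preserves : {P : ℕ → Set} → (∀ y → P y → P (⋆ y)) → ∀ k {y} → P y → P (⋆^ k y)
⋆^-preserves step zero        py = py
⋆^-preserves step (suc k) {y} py = ⋆^-preserves step k (step y py)

∣⇒∣⋆ : ∀ {d} y → d ∣ y → d ∣ ⋆ y
∣⇒∣⋆ y = ∣m⇒∣m*n (y + 1)

∣n⇒∤n+1 : ∀ {d n} → .{{NonTrivial d}} → d ∣ n → ¬ d ∣ n + 1
∣n⇒∤n+1 d∣n d∣n+1 = nonTrivial⇒≢1 (∣1⇒≡1 (∣m+n∣m⇒∣n d∣n+1 d∣n))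

∃-prime∣ : ∀ n → .{{NonTrivial n}} → ∃[ p ] Prime p × p ∣ n
∃-prime∣ n with factorise n {{nonTrivial⇒nonZero n}}
... | record { factors = [] ; isFactorisation = n≡1 } = contradiction n≡1 nonTrivial⇒≢1
... | record { factors = p ∷ _ ; isFactorisation = refl ; factorsPrime = p-prime ∷ _ } =
  p , p-prime , m∣m*n _

[m+n]%d≡[m%d+n]%d : ∀ m n d .{{_ : NonZero d}} → (m + n) % d ≡ (m % d + n) % d
[m+n]%d≡[m%d+n]%d m n d = begin
  (m + n) % d             ≡⟨ %-distribˡ-+ m n d ⟩
  (m % d + n % d) % d     ≡⟨ cong (λ r → (r + n % d) % d) (sym (m%n%n≡m%n m d)) ⟩
  (m % d % d + n % d) % d ≡⟨ sym (%-distribˡ-+ (m % d) n d) ⟩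
  (m % d + n) % d         ∎
  where open ≡-Reasoning

⋆-%-comm : ∀ y d .{{_ : NonZero d}} → ⋆ y % d ≡ ⋆ (y % d) % d
⋆-%-comm y d = begin
  (y * (y + 1)) % d                   ≡⟨ %-distribˡ-* y (y + 1) d ⟩
  (y % d * ((y + 1) % d)) % d         ≡⟨ cong (λ r → (y % d * r) % d) ([m+n]%d≡[m%d+n]%d y 1 d) ⟩
  (y % d * ((y % d + 1) % d)) % d     ≡⟨ cong (λ r → (r * ((y % d + 1) % d)) % d) (sym (m%n%n≡m%n y d)) ⟩
  (y % d % d * ((y % d + 1) % d)) % d ≡⟨ sym (%-distribˡ-* (y % d) (y % d + 1) d) ⟩
  (y % d * (y % d + 1)) % d           ∎
  where open ≡-Reasoning

OneOrTwoMod5 : ℕ → Set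
OneOrTwoMod5 y = y % 5 ≡ 1 ⊎ y % 5 ≡ 2

⋆-preserves-OneOrTwoMod5 : ∀ y → OneOrTwoMod5 y → OneOrTwoMod5 (⋆ y)
⋆-preserves-OneOrTwoMod5 y (inj₁ y≡1) = inj₂ (trans (⋆-%-comm y 5) (cong (λ r → ⋆ r % 5) y≡1))
⋆-preserves-OneOrTwoMod5 y (inj₂ y≡2) = inj₁ (trans (⋆-%-comm y 5) (cong (λ r → ⋆ r % 5) y≡2))

OneOrTwoMod5⇒5∤n+1 : ∀ {y} → OneOrTwoMod5 y → ¬ 5 ∣ y + 1
OneOrTwoMod5⇒5∤n+1 {y} y≡1∨2 5∣y+1
  with y % 5 | y≡1∨2 | trans (sym ([m+n]%d≡[m%d+n]%d y 1 5)) (n∣m⇒m%n≡0 (y + 1) 5 5∣y+1)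
... | _ | inj₁ refl | ()
... | _ | inj₂ refl | ()

theorem1 : (x : ℕ) → 1 ≤ x →
    Σ ℕ (λ p → Prime p × ((k : ℕ) → ¬ (p ∣ ⋆^ k x + 1)))
theorem1 x@(suc (suc _)) _ with ∃-prime∣ x
... | p , p-prime , p∣x =
  p , p-prime , λ k → ∣n⇒∤n+1 {{prime⇒nonTrivial p-prime}} (⋆^-preserves ∣⇒∣⋆ k p∣x)
theorem1 1 _ =
  5 , from-yes (prime? 5) ,
  λ k → OneOrTwoMod5⇒5∤n+1 (⋆^-preserves ⋆-preserves-OneOrTwoMod5 k (inj₁ refl))
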